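{- Let $n=ms+c$ with integers $m\ge 2$, $1\le c\le s$, and $\ell=s-c\ge 1$. Let $\mathcal F\subset 2^{[n]}$ be a shifted family and $d\ge 0$ an integer with $d(\mathcal F)>d$. Then for any integer $k$ with $0\le k\le d/m$ and any set $X\subset[d+m\ell]$ with $|X|=d-km$, the family $\mathcal F\cap\binom{[d+m\ell]\setminus X}{m}$ contains $\ell+k$ pairwise disjoint sets.
   Context: $[b]=\{1,\dots,b\}$; $\binom{Y}{m}$ is the family of $m$-element subsets of $Y$. A matching is a collection of pairwise disjoint sets and $\nu(\mathcal G)$ is the maximum size of a matching in $\mathcal G$. The deletion number of $\mathcal F\subset 2^{[n]}$ is \[ d(\mathcal F)=\min\Big\{|X|: X\subset[n],\ \nu\Big(\mathcal F\cap\binom{[n]\setminus X}{m}\Big)<\ell\Big\}. \] Writing a set as $(a_1,\dots,a_k)$ with $a_1<\dots<a_k$, $(a_1,\dots,a_k)$ can be shifted to $(b_1,\dots,b_k)$ if $a_i\ge b_i$ for all $i$; a family is shifted if it is closed under this operation. -}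

module Defs where

open import Data.Nat using (ℕ; zero; suc; _≤_; _<_; _<ᵇ_)
open import Data.Bool using (Bool; true; false)
open import Data.Fin using (Fin; toℕ) renaming (zero to fzero; suc to fsuc)
open import Data.Fin.Subset using (Subset; _⊆_; _∩_; ∣_∣; Empty; ∁)
open import Data.Vec using (Vec; []; _∷_; tabulate)
open import Data.List using (List; []; _∷_; map; length)
open import Data.List.Relation.Unary.All using (All)
open import Data.List.Relation.Unary.AllPairs using (AllPairs)
open import Data.List.Relation.Binary.Pointwise using (Pointwise)
open import Data.Product using (Σ; _×_)
open import Relation.Binary.PropositionalEquality using (_≡_)

Family : ℕ → Set
Family n = Subset n → Bool

elems : ∀ {n} → Subset n → List (Fin n)
elems []          = []
elems (true  ∷ p) = fzero ∷ map fsuc (elems p)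
elems (false ∷ p) = map fsuc (elems p)

ShiftsTo : ∀ {n} → Subset n → Subset n → Set
ShiftsTo A B = Pointwise (λ a b → toℕ b ≤ toℕ a) (elems A) (elems B)

Shifted : ∀ {n} → Family n → Set
Shifted F = ∀ A B → F A ≡ true → ShiftsTo A B → F B ≡ true

Disjoint : ∀ {n} → Subset n → Subset n → Set
Disjoint p q = Empty (p ∩ q)

HasMatching : ∀ {n} → (Subset n → Set) → ℕ → Set
HasMatching G k =
  Σ (List (Subset _)) λ M → length M ≡ k × All G M × AllPairs Disjoint M

IsMatchingNumber : ∀ {n} → (Subset n → Set) → ℕ → Set
IsMatchingNumber G v = HasMatching G v × (∀ k → HasMatching G k → k ≤ v)

MatchingNumberLt : ∀ {n} → (Subset n → Set) → ℕ → Set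
MatchingNumberLt G ℓ = Σ ℕ λ v → IsMatchingNumber G v × v < ℓ

Restrict : ∀ {n} → Family n → Subset n → ℕ → Subset n → Set
Restrict F Y m A = F A ≡ true × ∣ A ∣ ≡ m × A ⊆ Y

IsDeletionNumber : ∀ {n} → ℕ → ℕ → Family n → ℕ → Set
IsDeletionNumber {n} m ℓ F t =
  (Σ (Subset n) λ X → ∣ X ∣ ≡ t × MatchingNumberLt (Restrict F (∁ X) m) ℓ)
  × (∀ (X : Subset n) → MatchingNumberLt (Restrict F (∁ X) m) ℓ → t ≤ ∣ X ∣)

-- [b] as a subset of [n] (with [n] = Fin n, element i ↦ i+1): {i : toℕ i < b}
initSeg : ∀ {n} → ℕ → Subset n
initSeg b = tabulate (λ i → toℕ i <ᵇ b)

module Submission where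

-- Since d(F) > d, deleting any set X of at most d points leaves ℓ disjoint m-sets of F; as ν is
-- only specified relationally, such a matching is found by exhaustive search. Shiftedness pushes
-- it into [d + mℓ] ∖ X: while a member contains a point u outside this segment, trade u for a
-- point w of the segment missed by the matching. Such a w exists because the matching covers mℓ
-- points while |[d + mℓ] ∖ X| ≥ mℓ, and w < u, so the new member is a shift of the old one.
-- Finally induct on k: put one member T of the matching into X, so that |X| grows by m, and add
-- T back to the ℓ + (k - 1) disjoint sets found in [d + mℓ] ∖ (X ∪ T).

open import Defs
open import Data.Nat using (ℕ; zero; suc; _+_; _*_; _∸_; _⊓_; _≤_; _<_; _<ᵇ_; z≤n; s≤s)
open import Data.Nat.Properties
  using ( _≟_; suc-injective; ≤-refl; ≤-reflexive; ≤-trans; ≤-pred; <-≤-trans; <⇒≱; ≮⇒≥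
        ; m<n⇒m<1+n; <ᵇ⇒<; <⇒<ᵇ; +-suc; +-assoc; +-comm; +-identityʳ; +-monoˡ-≤; +-cancelˡ-≤
        ; m+n≤o⇒m≤o; m∸n+n≡m; *-zeroʳ; *-suc; ⊓-zeroʳ; ⊓-glb; module ≤-Reasoning)
open import Data.Bool using (true)
open import Data.Bool.Properties using (T-≡)
import Data.Bool.Properties as Bool
open import Data.Fin using (Fin; toℕ) renaming (zero to fzero; suc to fsuc)
import Data.Fin.Properties as Fin
open import Data.Fin.Subset
open import Data.Fin.Subset.Properties
open import Data.Vec using ([]; _∷_; here; there; _[_]≔_)
open import Data.Vec.Properties using ([]=⇒lookup; lookup⇒[]=; lookup∘tabulate)
open import Data.List using (List; []; _∷_; map; length)
open import Data.List.Properties using (length-map)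
open import Data.List.Relation.Unary.All as All using (All; []; _∷_)
open import Data.List.Relation.Unary.All.Properties as All using ()
open import Data.List.Relation.Unary.AllPairs using (AllPairs; []; _∷_)
import Data.List.Relation.Binary.Pointwise as Pointwise
open import Data.List.Relation.Binary.Pointwise using ([]; _∷_)
open import Data.Product using (Σ; ∃; _×_; _,_; proj₁; proj₂; uncurry)
import Data.Product as Prod
open import Data.Sum using (_⊎_; inj₁; inj₂; [_,_])
import Data.Sum as Sum
open import Function using (_∘_; case_of_; Equivalence)
open import Relation.Nullary using (Dec; yes; no; ¬?; contradiction)
open import Relation.Nullary.Decidable using (map′; _×-dec_)
open import Relation.Unary using (Decidable)
open import Relation.Binary.PropositionalEquality
  using (_≡_; _≢_; refl; sym; trans; cong; cong₂; subst; module ≡-Reasoning)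

private variable
  n m k : ℕ
  x u w : Fin n
  A B X Y : Subset n
  M : List (Subset n)

x∈p─q⁻ : ∀ (p q : Subset n) → x ∈ p ─ q → x ∈ p × x ∉ q
x∈p─q⁻ (s ∷ p) (outside ∷ q) here       = here , λ ()
x∈p─q⁻ (s ∷ p) (t ∷ q)       (there x∈) = Prod.map there (_∘ drop-there) (x∈p─q⁻ p q x∈)

disjoint⁺ : (∀ {x} → x ∈ A → x ∉ B) → Disjoint A B
disjoint⁺ {A = A} {B} f (x , x∈A∩B) = uncurry f (x∈p∩q⁻ A B x∈A∩B)

disjoint⁻ : Disjoint A B → x ∈ A → x ∉ B
disjoint⁻ A#B x∈A x∈B = A#B (_ , x∈p∩q⁺ (x∈A , x∈B))

disjoint? : ∀ (A B : Subset n) → Dec (Disjoint A B)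
disjoint? A B = ¬? (nonempty? (A ∩ B))

Empty[p─q]⇒p⊆q : ∀ (p q : Subset n) → Empty (p ─ q) → p ⊆ q
Empty[p─q]⇒p⊆q p q empty {x} x∈p with x ∈? q
... | yes x∈q = x∈q
... | no  x∉q = contradiction (x , x∈p∧x∉q⇒x∈p─q x∈p x∉q) empty

∣p∪q∣≡∣p∣+∣q∣ : ∀ (p q : Subset n) → Disjoint p q → ∣ p ∪ q ∣ ≡ ∣ p ∣ + ∣ q ∣
∣p∪q∣≡∣p∣+∣q∣ []            []            _   = refl
∣p∪q∣≡∣p∣+∣q∣ (inside ∷ p)  (inside ∷ q)  p#q = contradiction (fzero , here) p#q
∣p∪q∣≡∣p∣+∣q∣ (inside ∷ p)  (outside ∷ q) p#q = cong suc (∣p∪q∣≡∣p∣+∣q∣ p q (drop-∷-Empty p#q))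
∣p∪q∣≡∣p∣+∣q∣ (outside ∷ p) (inside ∷ q)  p#q =
  trans (cong suc (∣p∪q∣≡∣p∣+∣q∣ p q (drop-∷-Empty p#q))) (sym (+-suc ∣ p ∣ ∣ q ∣))
∣p∪q∣≡∣p∣+∣q∣ (outside ∷ p) (outside ∷ q) p#q = ∣p∪q∣≡∣p∣+∣q∣ p q (drop-∷-Empty p#q)

∣p─q∣+∣q∣≡∣p∣ : ∀ (p q : Subset n) → q ⊆ p → ∣ p ─ q ∣ + ∣ q ∣ ≡ ∣ p ∣
∣p─q∣+∣q∣≡∣p∣ []            []            _   = refl
∣p─q∣+∣q∣≡∣p∣ (inside ∷ p)  (inside ∷ q)  q⊆p =
  trans (+-suc ∣ p ─ q ∣ ∣ q ∣) (cong suc (∣p─q∣+∣q∣≡∣p∣ p q (drop-∷-⊆ q⊆p)))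
∣p─q∣+∣q∣≡∣p∣ (outside ∷ p) (inside ∷ q)  q⊆p with () ← q⊆p here
∣p─q∣+∣q∣≡∣p∣ (inside ∷ p)  (outside ∷ q) q⊆p = cong suc (∣p─q∣+∣q∣≡∣p∣ p q (drop-∷-⊆ q⊆p))
∣p─q∣+∣q∣≡∣p∣ (outside ∷ p) (outside ∷ q) q⊆p = ∣p─q∣+∣q∣≡∣p∣ p q (drop-∷-⊆ q⊆p)

⋃⊆⁺ : All (_⊆ Y) M → ⋃ M ⊆ Y
⋃⊆⁺ []             x∈ = contradiction x∈ ∉⊥
⋃⊆⁺ {M = A ∷ M} (A⊆Y ∷ M⊆Y) x∈ = [ A⊆Y , ⋃⊆⁺ M⊆Y ] (x∈p∪q⁻ A (⋃ M) x∈)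

⋃⊆⁻ : ⋃ M ⊆ Y → All (_⊆ Y) M
⋃⊆⁻ {M = []}    _   = []
⋃⊆⁻ {M = A ∷ M} ⋃⊆Y = (⋃⊆Y ∘ x∈p∪q⁺ ∘ inj₁) ∷ ⋃⊆⁻ (⋃⊆Y ∘ x∈p∪q⁺ ∘ inj₂)

x∉⋃⁻ : x ∉ ⋃ M → All (x ∉_) M
x∉⋃⁻ {M = []}    _    = []
x∉⋃⁻ {M = A ∷ M} x∉⋃ = (x∉⋃ ∘ x∈p∪q⁺ ∘ inj₁) ∷ x∉⋃⁻ (x∉⋃ ∘ x∈p∪q⁺ ∘ inj₂)

disjoint-⋃ : All (Disjoint A) M → Disjoint A (⋃ M)
disjoint-⋃ []          = disjoint⁺ λ _ → ∉⊥
disjoint-⋃ {M = B ∷ M} (A#B ∷ A#M) = disjoint⁺ λ x∈A x∈⋃ →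
  [ disjoint⁻ A#B x∈A , disjoint⁻ (disjoint-⋃ A#M) x∈A ] (x∈p∪q⁻ B (⋃ M) x∈⋃)

∣⋃∣≡*length : ∀ {n m} {M : List (Subset n)} → All (λ A → ∣ A ∣ ≡ m) M → AllPairs Disjoint M →
              ∣ ⋃ M ∣ ≡ m * length M
∣⋃∣≡*length {n = n} {m = m} {M = []}    []  []  = trans (∣⊥∣≡0 n) (sym (*-zeroʳ m))
∣⋃∣≡*length {m = m} {M = A ∷ M} (∣A∣ ∷ ∣M∣) (A#M ∷ M#) = begin
  ∣ A ∪ ⋃ M ∣         ≡⟨ ∣p∪q∣≡∣p∣+∣q∣ A (⋃ M) (disjoint-⋃ A#M) ⟩
  ∣ A ∣ + ∣ ⋃ M ∣     ≡⟨ cong₂ _+_ ∣A∣ (∣⋃∣≡*length ∣M∣ M#) ⟩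
  m + m * length M    ≡⟨ sym (*-suc m (length M)) ⟩
  m * suc (length M)  ∎
  where open ≡-Reasoning

x∈p[i]≔inside⁻ : ∀ (p : Subset n) i → x ∈ p [ i ]≔ inside → x ≡ i ⊎ x ∈ p
x∈p[i]≔inside⁻ (s ∷ p) fzero    here       = inj₁ refl
x∈p[i]≔inside⁻ (s ∷ p) fzero    (there x∈) = inj₂ (there x∈)
x∈p[i]≔inside⁻ (s ∷ p) (fsuc i) here       = inj₂ here
x∈p[i]≔inside⁻ (s ∷ p) (fsuc i) (there x∈) = Sum.map (cong fsuc) there (x∈p[i]≔inside⁻ p i x∈)

x∈p[i]≔outside⁻ : ∀ (p : Subset n) i → x ∈ p [ i ]≔ outside → x ≢ i × x ∈ p
x∈p[i]≔outside⁻ (s ∷ p) fzero    (there x∈) = (λ ()) , there x∈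
x∈p[i]≔outside⁻ (s ∷ p) (fsuc i) here       = (λ ()) , here
x∈p[i]≔outside⁻ (s ∷ p) (fsuc i) (there x∈) =
  Prod.map (_∘ Fin.suc-injective) there (x∈p[i]≔outside⁻ p i x∈)

∣p[i]≔inside∣ : ∀ (p : Subset n) i → i ∉ p → ∣ p [ i ]≔ inside ∣ ≡ suc ∣ p ∣
∣p[i]≔inside∣ (inside  ∷ p) fzero    i∉p = contradiction here i∉p
∣p[i]≔inside∣ (outside ∷ p) fzero    i∉p = refl
∣p[i]≔inside∣ (inside  ∷ p) (fsuc i) i∉p = cong suc (∣p[i]≔inside∣ p i (i∉p ∘ there))
∣p[i]≔inside∣ (outside ∷ p) (fsuc i) i∉p = ∣p[i]≔inside∣ p i (i∉p ∘ there)

∣p[i]≔outside∣ : ∀ (p : Subset n) i → i ∈ p → suc ∣ p [ i ]≔ outside ∣ ≡ ∣ p ∣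
∣p[i]≔outside∣ (inside  ∷ p) fzero    here        = refl
∣p[i]≔outside∣ (inside  ∷ p) (fsuc i) (there i∈p) = cong suc (∣p[i]≔outside∣ p i i∈p)
∣p[i]≔outside∣ (outside ∷ p) (fsuc i) (there i∈p) = ∣p[i]≔outside∣ p i i∈p

move : Fin n → Fin n → Subset n → Subset n
move u w A = A [ u ]≔ outside [ w ]≔ inside

x∈move⁻ : ∀ (A : Subset n) → x ∈ move u w A → x ≡ w ⊎ (x ≢ u × x ∈ A)
x∈move⁻ {u = u} {w} A x∈ = Sum.map₂ (x∈p[i]≔outside⁻ A u) (x∈p[i]≔inside⁻ (A [ u ]≔ outside) w x∈)

∣move∣ : ∀ (A : Subset n) → u ∈ A → w ∉ A → ∣ move u w A ∣ ≡ ∣ A ∣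
∣move∣ {u = u} {w} A u∈A w∉A = begin
  ∣ move u w A ∣            ≡⟨ ∣p[i]≔inside∣ (A [ u ]≔ outside) w w∉A[u]≔outside ⟩
  suc ∣ A [ u ]≔ outside ∣  ≡⟨ ∣p[i]≔outside∣ A u u∈A ⟩
  ∣ A ∣                     ∎
  where
  open ≡-Reasoning
  w∉A[u]≔outside : w ∉ A [ u ]≔ outside
  w∉A[u]≔outside = w∉A ∘ proj₂ ∘ x∈p[i]≔outside⁻ A u

shiftsTo-refl : ∀ (A : Subset n) → ShiftsTo A A
shiftsTo-refl A = Pointwise.refl ≤-refl

-- ShiftsTo unfolds to a relation between element lists, so its endpoints must be given explicitly.
shiftsTo-trans : ∀ (A B C : Subset n) → ShiftsTo A B → ShiftsTo B C → ShiftsTo A C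
shiftsTo-trans _ _ _ = Pointwise.transitive (λ b≤a c≤b → ≤-trans c≤b b≤a)

shiftsTo-∷ : ∀ s (A B : Subset n) → ShiftsTo A B → ShiftsTo (s ∷ A) (s ∷ B)
shiftsTo-∷ inside  _ _ A→B = z≤n ∷ Pointwise.map⁺ fsuc fsuc (Pointwise.map s≤s A→B)
shiftsTo-∷ outside _ _ A→B = Pointwise.map⁺ fsuc fsuc (Pointwise.map s≤s A→B)

shiftsTo-adjacent : ∀ (A : Subset n) → ShiftsTo (outside ∷ inside ∷ A) (inside ∷ outside ∷ A)
shiftsTo-adjacent A = z≤n ∷ shiftsTo-refl (outside ∷ outside ∷ A)

shiftsTo-pull : ∀ (A : Subset n) → u ∈ A → ShiftsTo (outside ∷ A) (inside ∷ A [ u ]≔ outside)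
shiftsTo-pull (inside  ∷ A) here = shiftsTo-adjacent A
shiftsTo-pull {u = fsuc u} (inside ∷ A) (there u∈A) =
  shiftsTo-trans (outside ∷ inside ∷ A) (inside ∷ outside ∷ A) (inside ∷ inside ∷ A [ u ]≔ outside)
    (shiftsTo-adjacent A)
    (shiftsTo-∷ inside (outside ∷ A) (inside ∷ A [ u ]≔ outside) (shiftsTo-pull A u∈A))
shiftsTo-pull {u = fsuc u} (outside ∷ A) (there u∈A) =
  shiftsTo-trans (outside ∷ outside ∷ A) (outside ∷ inside ∷ A [ u ]≔ outside)
                 (inside ∷ outside ∷ A [ u ]≔ outside)
    (shiftsTo-∷ outside (outside ∷ A) (inside ∷ A [ u ]≔ outside) (shiftsTo-pull A u∈A))
    (shiftsTo-adjacent (A [ u ]≔ outside))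

move-shiftsTo : ∀ (A : Subset n) → u ∈ A → w ∉ A → toℕ w < toℕ u → ShiftsTo A (move u w A)
move-shiftsTo {u = fsuc u} {fzero}  (inside  ∷ A) _           w∉A _ = contradiction here w∉A
move-shiftsTo {u = fsuc u} {fzero}  (outside ∷ A) (there u∈A) _   _ = shiftsTo-pull A u∈A
move-shiftsTo {u = fsuc u} {fsuc w} (s ∷ A) (there u∈A) w∉A (s≤s w<u) =
  shiftsTo-∷ s A (move u w A) (move-shiftsTo A u∈A (w∉A ∘ there) w<u)

relocate : Fin n → Fin n → Subset n → Subset n
relocate u w A with u ∈? A
... | yes _ = move u w A
... | no  _ = A

x∈relocate⁻ : ∀ u w (A : Subset n) → x ∈ relocate u w A → (x ≡ w × u ∈ A) ⊎ (x ≢ u × x ∈ A)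
x∈relocate⁻ u w A x∈ with u ∈? A
... | yes u∈A = Sum.map₁ (_, u∈A) (x∈move⁻ A x∈)
... | no  u∉A = inj₂ ((λ { refl → u∉A x∈ }) , x∈)

∣relocate∣ : ∀ u w (A : Subset n) → w ∉ A → ∣ relocate u w A ∣ ≡ ∣ A ∣
∣relocate∣ u w A w∉A with u ∈? A
... | yes u∈A = ∣move∣ A u∈A w∉A
... | no  _   = refl

relocate-shiftsTo : ∀ u w (A : Subset n) → w ∉ A → (u ∈ A → toℕ w < toℕ u) →
                    ShiftsTo A (relocate u w A)
relocate-shiftsTo u w A w∉A w<u with u ∈? A
... | yes u∈A = move-shiftsTo A u∈A w∉A (w<u u∈A)
... | no  _   = shiftsTo-refl A

relocate-disjoint : ∀ u w (A B : Subset n) → w ∉ A → w ∉ B → Disjoint A B →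
                    Disjoint (relocate u w A) (relocate u w B)
relocate-disjoint u w A B w∉A w∉B A#B = disjoint⁺ λ x∈A′ x∈B′ →
  case (x∈relocate⁻ u w A x∈A′ , x∈relocate⁻ u w B x∈B′) of λ where
    (inj₁ (_ , u∈A)  , inj₁ (_ , u∈B))  → disjoint⁻ A#B u∈A u∈B
    (inj₁ (refl , _) , inj₂ (_ , w∈B))  → w∉B w∈B
    (inj₂ (_ , w∈A)  , inj₁ (refl , _)) → w∉A w∈A
    (inj₂ (_ , x∈A)  , inj₂ (_ , x∈B))  → disjoint⁻ A#B x∈A x∈B

⋃-relocate⁻ : ∀ u w (M : List (Subset n)) → x ∈ ⋃ (map (relocate u w) M) → x ≡ w ⊎ (x ≢ u × x ∈ ⋃ M)
⋃-relocate⁻ u w []      x∈ = contradiction x∈ ∉⊥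
⋃-relocate⁻ u w (A ∷ M) x∈ with x∈p∪q⁻ (relocate u w A) (⋃ (map (relocate u w) M)) x∈
... | inj₁ x∈A′ = Sum.map proj₁ (Prod.map₂ (x∈p∪q⁺ ∘ inj₁)) (x∈relocate⁻ u w A x∈A′)
... | inj₂ x∈M′ = Sum.map₂ (Prod.map₂ (x∈p∪q⁺ ∘ inj₂)) (⋃-relocate⁻ u w M x∈M′)

relocate-pairwise : ∀ u w {M : List (Subset n)} → All (w ∉_) M → AllPairs Disjoint M →
                    AllPairs Disjoint (map (relocate u w) M)
relocate-pairwise u w {[]}    []          []         = []
relocate-pairwise u w {A ∷ M} (w∉A ∷ w∉M) (A#M ∷ M#) =
  All.map⁺ (All.zipWith (λ (w∉B , A#B) → relocate-disjoint u w A _ w∉A w∉B A#B) (w∉M , A#M))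
  ∷ relocate-pairwise u w w∉M M#

Avoiding : (Subset n → Set) → Subset n → Subset n → Set
Avoiding G A B = G B × Disjoint A B

hasMatching-map : ∀ {G H : Subset n → Set} → (∀ {A} → G A → H A) →
                  HasMatching G k → HasMatching H k
hasMatching-map G⇒H (M , ∣M∣ , M∈G , M#) = M , ∣M∣ , All.map G⇒H M∈G , M#

hasMatching-∷⁺ : ∀ {G : Subset n → Set} A → G A → HasMatching (Avoiding G A) k →
                 HasMatching G (suc k)
hasMatching-∷⁺ A GA (M , ∣M∣ , M∈ , M#) =
  let M∈G , A#M = All.unzip M∈ in A ∷ M , cong suc ∣M∣ , GA ∷ M∈G , A#M ∷ M#

hasMatching-∷⁻ : ∀ {G : Subset n → Set} → HasMatching G (suc k) →
                 ∃ λ A → G A × HasMatching (Avoiding G A) k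
hasMatching-∷⁻ (A ∷ M , ∣AM∣ , GA ∷ M∈G , A#M ∷ M#) =
  A , GA , M , suc-injective ∣AM∣ , All.zip (M∈G , A#M) , M#

hasMatching? : ∀ (G : Subset n → Set) → Decidable G → ∀ k → Dec (HasMatching G k)
hasMatching? G G? zero    = yes ([] , refl , [] , [])
hasMatching? G G? (suc k) =
  map′ (λ (A , GA , M) → hasMatching-∷⁺ A GA M) hasMatching-∷⁻
    (anySubset? λ A → G? A ×-dec hasMatching? (Avoiding G A) (λ B → G? B ×-dec disjoint? A B) k)

hasMatching-≤ : ∀ {G : Subset n → Set} {j} → j ≤ k → HasMatching G k → HasMatching G j
hasMatching-≤ z≤n       _ = [] , refl , [] , []
hasMatching-≤ (s≤s j≤k) M =
  let A , GA , M′ = hasMatching-∷⁻ M in hasMatching-∷⁺ A GA (hasMatching-≤ j≤k M′)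

hasMatching⊎matchingNumber< : ∀ (G : Subset n → Set) → Decidable G → ∀ k →
                              HasMatching G k ⊎ MatchingNumberLt G k
hasMatching⊎matchingNumber< G G? zero = inj₁ ([] , refl , [] , [])
hasMatching⊎matchingNumber< G G? (suc k) with hasMatching⊎matchingNumber< G G? k
... | inj₂ (v , ν≡v , v<k) = inj₂ (v , ν≡v , m<n⇒m<1+n v<k)
... | inj₁ Mₖ with hasMatching? G G? (suc k)
...   | yes Mₖ₊₁ = inj₁ Mₖ₊₁
...   | no ¬Mₖ₊₁ = inj₂ (k , (Mₖ , maximal) , ≤-refl)
  where
  maximal : ∀ j → HasMatching G j → j ≤ k
  maximal j Mⱼ = ≮⇒≥ (¬Mₖ₊₁ ∘ λ k<j → hasMatching-≤ k<j Mⱼ)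

restrict? : ∀ (F : Family n) Y m → Decidable (Restrict F Y m)
restrict? F Y m A = (F A Bool.≟ true) ×-dec (∣ A ∣ ≟ m) ×-dec (A ⊆? Y)

restrict-─ : ∀ {F : Family n} {Y T} → Restrict F (Y ─ T) m A → Avoiding (Restrict F Y m) T A
restrict-─ {Y = Y} {T} (FA , ∣A∣ , A⊆Y─T) =
  (FA , ∣A∣ , p─q⊆p Y T ∘ A⊆Y─T) , disjoint⁺ λ x∈T x∈A → proj₂ (x∈p─q⁻ Y T (A⊆Y─T x∈A)) x∈T

module Compression {n m : ℕ} {F : Family n} (shifted : Shifted F) {Z J : Subset n} (J⊆Z : J ⊆ Z)
                   (J-below : ∀ {u w} → u ∈ Z → u ∉ J → w ∈ J → toℕ w < toℕ u) where

  relocate-restrict : ∀ {u w} A → u ∉ J → w ∈ J → w ∉ A →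
                      Restrict F Z m A → Restrict F Z m (relocate u w A)
  relocate-restrict {u} {w} A u∉J w∈J w∉A (FA , ∣A∣ , A⊆Z) =
      shifted A _ FA (relocate-shiftsTo u w A w∉A λ u∈A → J-below (A⊆Z u∈A) u∉J w∈J)
    , trans (∣relocate∣ u w A w∉A) ∣A∣
    , λ {x} x∈ → [ (λ { (refl , _) → J⊆Z w∈J }) , A⊆Z ∘ proj₂ ] (x∈relocate⁻ {x = x} u w A x∈)

  ⋃-relocate-─ : ∀ {u w} M → u ∈ ⋃ M → u ∉ J → w ∈ J → ⋃ (map (relocate u w) M) ─ J ⊂ ⋃ M ─ J
  ⋃-relocate-─ {u} {w} M u∈M u∉J w∈J = shrink , u , x∈p∧x∉q⇒x∈p─q u∈M u∉J , u∉M′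
    where
    shrink : ⋃ (map (relocate u w) M) ─ J ⊆ ⋃ M ─ J
    shrink x∈ with x∈p─q⁻ _ J x∈
    ... | x∈M′ , x∉J = case ⋃-relocate⁻ u w M x∈M′ of λ where
      (inj₁ refl)       → contradiction w∈J x∉J
      (inj₂ (_ , x∈M)) → x∈p∧x∉q⇒x∈p─q x∈M x∉J
    u∉M′ : u ∉ ⋃ (map (relocate u w) M) ─ J
    u∉M′ u∈ = case ⋃-relocate⁻ u w M (proj₁ (x∈p─q⁻ _ J u∈)) of λ where
      (inj₁ refl)      → u∉J w∈J
      (inj₂ (u≢u , _)) → u≢u refl

  compress : ∀ {k} fuel (M : List (Subset n)) → length M ≡ k → All (Restrict F Z m) M →
             AllPairs Disjoint M → m * k ≤ ∣ J ∣ → ∣ ⋃ M ─ J ∣ < fuel →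
             HasMatching (Restrict F J m) k
  compress {k} (suc fuel) M ∣M∣ M∈ M# room measure with nonempty? (⋃ M ─ J)
  ... | no ⋃M─J-empty = M , ∣M∣ , All.zipWith (λ ((FA , ∣A∣ , _) , A⊆J) → FA , ∣A∣ , A⊆J)
                                      (M∈ , ⋃⊆⁻ (Empty[p─q]⇒p⊆q (⋃ M) J ⋃M─J-empty)) , M#
  ... | yes (u , u∈M─J) with x∈p─q⁻ (⋃ M) J u∈M─J | nonempty? (J ─ ⋃ M)
  ...   | u∈M , u∉J | no J─⋃M-empty = contradiction room (<⇒≱ (begin-strict
    ∣ J ∣            <⟨ p⊂q⇒∣p∣<∣q∣ (Empty[p─q]⇒p⊆q J (⋃ M) J─⋃M-empty , u , u∈M , u∉J) ⟩
    ∣ ⋃ M ∣          ≡⟨ ∣⋃∣≡*length (All.map (proj₁ ∘ proj₂) M∈) M# ⟩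
    m * length M     ≡⟨ cong (m *_) ∣M∣ ⟩
    m * k            ∎))
    where open ≤-Reasoning
  ...   | u∈M , u∉J | yes (w , w∈J─M) =
    let w∈J , w∉M = x∈p─q⁻ J (⋃ M) w∈J─M
        w∉M′ = x∉⋃⁻ w∉M
    in compress fuel (map (relocate u w) M) (trans (length-map _ M) ∣M∣)
         (All.map⁺ (All.zipWith (λ (A∈ , w∉A) → relocate-restrict _ u∉J w∈J w∉A A∈) (M∈ , w∉M′)))
         (relocate-pairwise u w w∉M′ M#) room
         (<-≤-trans (p⊂q⇒∣p∣<∣q∣ (⋃-relocate-─ M u∈M u∉J w∈J)) (≤-pred measure))

  compress-matching : HasMatching (Restrict F Z m) k → m * k ≤ ∣ J ∣ →
                      HasMatching (Restrict F J m) k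
  compress-matching (M , ∣M∣ , M∈ , M#) room = compress _ M ∣M∣ M∈ M# room ≤-refl

x∈initSeg⁻ : ∀ b → x ∈ initSeg {n} b → toℕ x < b
x∈initSeg⁻ {x = x} b x∈ =
  <ᵇ⇒< _ _ (Equivalence.from T-≡
    (trans (sym (lookup∘tabulate (λ i → toℕ i <ᵇ b) x)) ([]=⇒lookup x∈)))

x∈initSeg⁺ : ∀ b → toℕ x < b → x ∈ initSeg {n} b
x∈initSeg⁺ {x = x} b x<b =
  lookup⇒[]= x _ (trans (lookup∘tabulate (λ i → toℕ i <ᵇ b) x) (Equivalence.to T-≡ (<⇒<ᵇ x<b)))

∣initSeg∣ : ∀ n k → ∣ initSeg {n} k ∣ ≡ n ⊓ k
∣initSeg∣ zero    k       = refl
∣initSeg∣ (suc n) zero    = trans (∣initSeg∣ n zero) (⊓-zeroʳ n)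
∣initSeg∣ (suc n) (suc k) = cong suc (∣initSeg∣ n k)

initSeg─-room : ∀ b (X P : Subset n) → X ⊆ initSeg b → Disjoint X P → ∣ X ∣ + ∣ P ∣ ≤ b →
                ∣ P ∣ ≤ ∣ initSeg b ─ X ∣
initSeg─-room {n} b X P X⊆I X#P X+P≤b = +-cancelˡ-≤ ∣ X ∣ _ _ (begin
  ∣ X ∣ + ∣ P ∣       ≤⟨ ⊓-glb X+P≤n X+P≤b ⟩
  n ⊓ b               ≡⟨ sym (∣initSeg∣ n b) ⟩
  ∣ I ∣               ≡⟨ sym (∣p─q∣+∣q∣≡∣p∣ I X X⊆I) ⟩
  ∣ I ─ X ∣ + ∣ X ∣   ≡⟨ +-comm ∣ I ─ X ∣ ∣ X ∣ ⟩
  ∣ X ∣ + ∣ I ─ X ∣   ∎)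
  where
  I : Subset n
  I = initSeg b
  X+P≤n : ∣ X ∣ + ∣ P ∣ ≤ n
  X+P≤n = subst (_≤ n) (∣p∪q∣≡∣p∣+∣q∣ X P X#P) (∣p∣≤n (X ∪ P))
  open ≤-Reasoning

matching-room : ∀ {F : Family n} b X → HasMatching (Restrict F (∁ X) m) k → X ⊆ initSeg b →
                ∣ X ∣ + m * k ≤ b → m * k ≤ ∣ initSeg b ─ X ∣
matching-room {m = m} {k = k} b X (M , ∣M∣ , M∈ , M#) X⊆I X+mk≤b =
  subst (_≤ _) ∣⋃M∣
    (initSeg─-room b X (⋃ M) X⊆I X#⋃M (subst (λ s → ∣ X ∣ + s ≤ b) (sym ∣⋃M∣) X+mk≤b))
  where
  ∣⋃M∣ : ∣ ⋃ M ∣ ≡ m * k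
  ∣⋃M∣ = trans (∣⋃∣≡*length (All.map (proj₁ ∘ proj₂) M∈) M#) (cong (m *_) ∣M∣)
  X#⋃M : Disjoint X (⋃ M)
  X#⋃M = disjoint⁺ λ x∈X x∈⋃M → x∈∁p⇒x∉p (⋃⊆⁺ (All.map (proj₂ ∘ proj₂) M∈) x∈⋃M) x∈X

initSeg─-below : ∀ b → u ∈ ∁ X → u ∉ initSeg b ─ X → w ∈ initSeg b ─ X → toℕ w < toℕ u
initSeg─-below {X = X} b u∉X u∉I─X w∈I─X =
  <-≤-trans (x∈initSeg⁻ b (proj₁ (x∈p─q⁻ _ X w∈I─X)))
            (≮⇒≥ λ u<b → u∉I─X (x∈p∧x∉q⇒x∈p─q (x∈initSeg⁺ b u<b) (x∈∁p⇒x∉p u∉X)))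

module _ {n m ℓ : ℕ} (ℓ≥1 : 1 ≤ ℓ) {F : Family n} (shifted : Shifted F) {d t : ℕ}
         (deletion : IsDeletionNumber m ℓ F t) (d<t : d < t) where

  I : Subset n
  I = initSeg (d + m * ℓ)

  matching-avoiding : ∀ X → ∣ X ∣ ≤ d → HasMatching (Restrict F (∁ X) m) ℓ
  matching-avoiding X ∣X∣≤d
    with hasMatching⊎matchingNumber< (Restrict F (∁ X) m) (restrict? F (∁ X) m) ℓ
  ... | inj₁ M   = M
  ... | inj₂ ν<ℓ = contradiction (≤-trans (proj₂ deletion X ν<ℓ) ∣X∣≤d) (<⇒≱ d<t)

  matching-in-segment : ∀ X → X ⊆ I → ∣ X ∣ ≤ d → HasMatching (Restrict F (I ─ X) m) ℓ
  matching-in-segment X X⊆I ∣X∣≤d =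
    compress-matching avoiding (matching-room (d + m * ℓ) X avoiding X⊆I (+-monoˡ-≤ (m * ℓ) ∣X∣≤d))
    where
    avoiding : HasMatching (Restrict F (∁ X) m) ℓ
    avoiding = matching-avoiding X ∣X∣≤d
    open Compression shifted (x∉p⇒x∈∁p ∘ proj₂ ∘ x∈p─q⁻ I X) (initSeg─-below (d + m * ℓ))

  matching-extends : ∀ k X → X ⊆ I → ∣ X ∣ + k * m ≡ d → HasMatching (Restrict F (I ─ X) m) (ℓ + k)
  matching-extends zero X X⊆I ∣X∣+0≡d =
    subst (HasMatching _) (sym (+-identityʳ ℓ))
      (matching-in-segment X X⊆I (m+n≤o⇒m≤o ∣ X ∣ (≤-reflexive ∣X∣+0≡d)))
  matching-extends (suc k) X X⊆I ∣X∣+[1+k]m≡d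
    with T , T∈@(_ , ∣T∣ , T⊆I─X) , _ ← hasMatching-∷⁻ (hasMatching-≤ ℓ≥1
           (matching-in-segment X X⊆I (m+n≤o⇒m≤o ∣ X ∣ (≤-reflexive ∣X∣+[1+k]m≡d)))) =
    subst (HasMatching _) (sym (+-suc ℓ k))
      (hasMatching-∷⁺ T T∈ (hasMatching-map (restrict-─ {F = F}) rest))
    where
    X#T : Disjoint X T
    X#T = disjoint⁺ λ x∈X x∈T → proj₂ (x∈p─q⁻ I X (T⊆I─X x∈T)) x∈X
    X∪T⊆I : X ∪ T ⊆ I
    X∪T⊆I = [ X⊆I , p─q⊆p I X ∘ T⊆I─X ] ∘ x∈p∪q⁻ X T
    ∣X∪T∣+km≡d : ∣ X ∪ T ∣ + k * m ≡ d
    ∣X∪T∣+km≡d = begin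
      ∣ X ∪ T ∣ + k * m        ≡⟨ cong (_+ k * m) (∣p∪q∣≡∣p∣+∣q∣ X T X#T) ⟩
      ∣ X ∣ + ∣ T ∣ + k * m    ≡⟨ cong (λ s → ∣ X ∣ + s + k * m) ∣T∣ ⟩
      ∣ X ∣ + m + k * m        ≡⟨ +-assoc ∣ X ∣ m (k * m) ⟩
      ∣ X ∣ + suc k * m        ≡⟨ ∣X∣+[1+k]m≡d ⟩
      d                        ∎
      where open ≡-Reasoning
    rest : HasMatching (Restrict F (I ─ X ─ T) m) (ℓ + k)
    rest = subst (λ Y → HasMatching (Restrict F Y m) (ℓ + k)) (sym (p─q─r≡p─q∪r I X T))
             (matching-extends k (X ∪ T) X∪T⊆I ∣X∪T∣+km≡d)

lemma3 : (m s c ℓ n : ℕ) → 2 ≤ m → 1 ≤ c → c ≤ s → ℓ ≡ s ∸ c → 1 ≤ ℓ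
    → n ≡ m * s + c
    → (F : Family n) → Shifted F
    → (d : ℕ) → Σ ℕ (λ t → IsDeletionNumber m ℓ F t × d < t)
    → (k : ℕ) → k * m ≤ d
    → (X : Subset n) → X ⊆ initSeg (d + m * ℓ) → ∣ X ∣ ≡ d ∸ k * m
    → HasMatching (Restrict F (initSeg (d + m * ℓ) ─ X) m) (ℓ + k)
lemma3 m _ _ ℓ _ _ _ _ _ ℓ≥1 _ F shifted d (t , deletion , d<t) k km≤d X X⊆I ∣X∣≡d∸km =
  matching-extends ℓ≥1 shifted deletion d<t k X X⊆I (begin
    ∣ X ∣ + k * m      ≡⟨ cong (_+ k * m) ∣X∣≡d∸km ⟩
    d ∸ k * m + k * m  ≡⟨ m∸n+n≡m km≤d ⟩
    d                  ∎)
  where open ≡-Reasoning
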